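{- Let $n,m$ be integers with $1\le m\le n-2$ and let $G$ be a connected simple graph on $n$ vertices with vertex $2$-partiteness $v_2(G)\le m$. (1) If $n-m$ is even, then $W(G)\ge \frac{3n^2+m^2-2mn-4n+2m}{4}$, with equality if and only if $G\cong K_m\vee\big(\overline{K_{(n-m)/2}}\vee\overline{K_{(n-m)/2}}\big)$. (2) If $n-m$ is odd, then $W(G)\ge\frac{3n^2+m^2-2mn-4n+2m+1}{4}$, with equality if and only if $G\cong K_m\vee\big(\overline{K_{(n-m+1)/2}}\vee\overline{K_{(n-m-1)/2}}\big)$.
   Context: The vertex $2$-partiteness $v_2(G)$ is the minimum number of vertices whose deletion from $G$ yields a bipartite graph (parts possibly empty). The Wiener index is $W(G)=\sum_{\{u,v\}\subseteq V(G)}d(u,v)$ over unordered pairs of distinct vertices, $d(u,v)$ the shortest-path distance. $G_1\vee G_2$ is the join (disjoint union plus all edges between the two vertex sets); $\overline{K_r}$ is the edgeless graph on $r$ vertices; $K_m$ the complete graph. -}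

module Defs where

open import Data.Bool using (Bool; true; false; _∧_; _∨_; not; if_then_else_)
open import Data.Nat using (ℕ; zero; suc; _+_; _<ᵇ_)
open import Data.Fin using (Fin; toℕ; splitAt; _≟_)
open import Data.Fin.Subset using (Subset; _∉_; ∣_∣)
open import Data.List using (allFin; map)
open import Data.Bool.ListAction using (any)
open import Data.Nat.ListAction using (sum)
open import Data.Sum using (inj₁; inj₂)
open import Data.Product using (Σ; _×_; ∃)
open import Data.Nat using (_≤_)
open import Function.Bundles using (_⤖_; Bijection)
open import Relation.Binary.PropositionalEquality using (_≡_; _≢_)
open import Relation.Nullary.Decidable using (⌊_⌋)

Graph : ℕ → Set
Graph n = Fin n → Fin n → Bool

record IsSimple {n : ℕ} (G : Graph n) : Set where
  field
    symmetric   : ∀ u v → G u v ≡ G v u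
    irreflexive : ∀ u → G u u ≡ false

data Walk {n : ℕ} (G : Graph n) : Fin n → Fin n → Set where
  here : ∀ {u} → Walk G u u
  step : ∀ {u w v} → G u w ≡ true → Walk G w v → Walk G u v

Connected : ∀ {n} → Graph n → Set
Connected G = ∀ u v → Walk G u v

reach : ∀ {n} → Graph n → ℕ → Fin n → Fin n → Bool
reach G zero    u v = ⌊ u ≟ v ⌋
reach {n} G (suc k) u v =
  reach G k u v ∨ any (λ w → G u w ∧ reach G k w v) (allFin n)

-- least k ≥ start (searching at most fuel steps) with p k = true;
-- returns start + fuel if none found.
leastFrom : (ℕ → Bool) → ℕ → ℕ → ℕ
leastFrom p start zero       = start
leastFrom p start (suc fuel) =
  if p start then start else leastFrom p (suc start) fuel

-- Shortest-path distance: least k such that a walk of length ≤ k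
-- from u to v exists (searching k = 0 .. n; in a connected graph on
-- n vertices the distance is ≤ n - 1, so the search always succeeds).
dist : ∀ {n} → Graph n → Fin n → Fin n → ℕ
dist {n} G u v = leastFrom (λ k → reach G k u v) 0 (suc n)

wiener : ∀ {n} → Graph n → ℕ
wiener {n} G =
  sum (map (λ u → sum (map (λ v → if toℕ u <ᵇ toℕ v then dist G u v else 0)
                             (allFin n)))
           (allFin n))

-- v₂(G) ≤ m : some set S of at most m vertices whose deletion leaves
-- a bipartite graph (2-colouring of the remaining vertices).
VertexBipartitenessAtMost : ∀ {n} → Graph n → ℕ → Set
VertexBipartitenessAtMost {n} G m =
  Σ (Subset n) λ S → (∣ S ∣ ≤ m) × ∃ λ (c : Fin n → Bool) →
    ∀ u v → u ∉ S → v ∉ S → G u v ≡ true → c u ≢ c v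

complete : (m : ℕ) → Graph m
complete m u v = not ⌊ u ≟ v ⌋

edgeless : (r : ℕ) → Graph r
edgeless r u v = false

-- Join of two graphs (vertices of G come first).
join : ∀ {a b} → Graph a → Graph b → Graph (a + b)
join {a} G H u v with splitAt a u | splitAt a v
... | inj₁ x | inj₁ y = G x y
... | inj₂ x | inj₂ y = H x y
... | inj₁ _ | inj₂ _ = true
... | inj₂ _ | inj₁ _ = true

_≅_ : ∀ {n k} → Graph n → Graph k → Set
_≅_ {n} {k} G H = Σ (Fin n ⤖ Fin k) λ f →
  ∀ u v → G u v ≡ H (Bijection.to f u) (Bijection.to f v)

module Submission where

-- Let G be simple on n vertices with v₂(G) ≤ m, where 1 ≤ m ≤ n − 2. Delete a set of z ≤ m
-- vertices so that the rest is bipartite, with colour classes of sizes p ≥ q; this assigns each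
-- vertex a role K (deleted), L or R. No edge of G joins two vertices of one colour class, so G is
-- a spanning subgraph of the "template" K_z ∨ (K̄_p ∨ K̄_q) on the same roles, whose distances
-- are 1, or 2 inside a colour class. Hence W(G) ≥ T, the template sum, and a symmetric double
-- sum computed by counting roles gives 2T + n + p + q = n² + p² + q². Writing m = z + e,
-- p = q + d and n = m + 2 + s turns this into the identity
--   4T + 2mn + 4n = 3n² + m² + 2m + e(2 + 2s + e) + d²,
-- and a parity argument on p + q = e + (n − m) bounds the excess below by 0 or 1.
-- Equality forces e = 0, the balanced d and W(G) = T; then every pair is at template distance,
-- so G is the template, and templates with equal role counts are isomorphic through a
-- role-preserving permutation. Conversely the extremal graph is a template whose deleted
-- vertices are common neighbours, so its Wiener index is T.

open import Defs
open import Data.Nat using (ℕ; suc; _+_; _*_; _≤_)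
open import Data.Product using (_×_)
open import Relation.Binary.PropositionalEquality using (_≡_)

open import Data.Bool using (Bool; true; false; T; if_then_else_; _∧_; _∨_; not)
open import Data.Bool.ListAction using (any)
open import Data.Bool.Properties using (∨-zeroʳ; ∧-zeroʳ; ∧-identityʳ; not-injective)
open import Data.Fin as Fin using (Fin; toℕ; _≟_; _↑ˡ_; _↑ʳ_; splitAt)
open import Data.Fin.Permutation as Perm using (Permutation; _⟨$⟩ʳ_; _⟨$⟩ˡ_)
open import Data.Fin.Properties using (toℕ-injective; ↑ˡ-injective; ↑ʳ-injective; splitAt⁻¹-↑ˡ; splitAt⁻¹-↑ʳ)
open import Data.Fin.Subset using (Subset; _∉_; ∣_∣)
open import Data.List using (_∷_; tabulate; map; allFin)
open import Data.List.Membership.Propositional using (_∈_)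
open import Data.List.Membership.Propositional.Properties using (∈-tabulate⁺)
open import Data.List.Properties using (map-tabulate)
open import Data.List.Relation.Unary.Any using (here; there)
open import Data.Nat using (zero; z≤n; s≤s; _<_; _<ᵇ_)
import Data.Nat.ListAction as List
open import Data.Nat.Properties hiding (_≟_)
open import Data.Nat.Tactic.RingSolver using (solve-∀)
open import Algebra.Properties.Semiring.Sum +-*-semiring
  using (sum; ∑-distrib-+; sum-cong-≗; sum-permute; sum-remove; *-distribˡ-sum; *-distribʳ-sum)
open import Data.Product using (Σ; ∃; _,_; proj₁; proj₂)
open import Data.Sum using (inj₁; inj₂; reduce)
open import Data.Vec using ([]; _∷_; lookup)
open import Data.Vec.Functional using (_++_)
open import Data.Vec.Functional.Properties using (lookup-++ˡ; lookup-++ʳ)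
open import Data.Vec.Properties using ([]=⇒lookup)
open import Function using (_∘_)
open import Function.Properties.Bijection using (⤖⇒↔)
open import Function.Properties.Inverse using (↔⇒⤖)
open import Relation.Binary.Definitions using (DecidableEquality; tri<; tri≈; tri>)
open import Relation.Binary.PropositionalEquality
  using (refl; sym; trans; cong; cong₂; subst; subst₂; _≢_; module ≡-Reasoning)
open import Relation.Nullary using (Dec; yes; no; ¬_; contradiction)
open import Relation.Nullary.Decidable using (⌊_⌋; isYes≗does; dec-true; dec-false)

⌊⌋-yes : ∀ {A : Set} (d : Dec A) → A → ⌊ d ⌋ ≡ true
⌊⌋-yes d a = trans (isYes≗does d) (dec-true d a)

⌊⌋-no : ∀ {A : Set} (d : Dec A) → ¬ A → ⌊ d ⌋ ≡ false
⌊⌋-no d ¬a = trans (isYes≗does d) (dec-false d ¬a)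

⌊≟⌋-sym : ∀ {n} (u v : Fin n) → ⌊ u ≟ v ⌋ ≡ ⌊ v ≟ u ⌋
⌊≟⌋-sym u v with u ≟ v
... | yes refl = sym (⌊⌋-yes (u ≟ u) refl)
... | no  u≢v  = sym (⌊⌋-no (v ≟ u) (u≢v ∘ sym))

⌊≟⌋-injective : ∀ {m n} (f : Fin m → Fin n) → (∀ {u v} → f u ≡ f v → u ≡ v) →
                ∀ u v → ⌊ f u ≟ f v ⌋ ≡ ⌊ u ≟ v ⌋
⌊≟⌋-injective f inj u v with u ≟ v
... | yes refl = ⌊⌋-yes (f u ≟ f u) refl
... | no  u≢v  = ⌊⌋-no (f u ≟ f v) (u≢v ∘ inj)

indicator : Bool → ℕ
indicator true  = 1
indicator false = 0

any-intro : ∀ {A : Set} (p : A → Bool) {x : A} {xs} → x ∈ xs → p x ≡ true → any p xs ≡ true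
any-intro p {xs = _ ∷ xs} (here refl) px = cong (_∨ any p xs) px
any-intro p {xs = y ∷ _} (there x∈xs) px = trans (cong (p y ∨_) (any-intro p x∈xs px)) (∨-zeroʳ (p y))

any-elim : ∀ {A : Set} (p : A → Bool) xs → any p xs ≡ true → ∃ λ x → p x ≡ true
any-elim p (x ∷ xs) any≡ with p x in px
... | true  = x , px
... | false = any-elim p xs any≡

inj₁≢inj₂ : ∀ {A B : Set} {x : A} {y : B} → inj₁ x ≢ inj₂ y
inj₁≢inj₂ ()

∑-mono : ∀ {n} {f g : Fin n → ℕ} → (∀ i → f i ≤ g i) → sum f ≤ sum g
∑-mono {zero}  f≤g = z≤n
∑-mono {suc n} f≤g = +-mono-≤ (f≤g Fin.zero) (∑-mono (f≤g ∘ Fin.suc))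

∑-rigid : ∀ {n} {f g : Fin n → ℕ} → (∀ i → f i ≤ g i) → sum f ≡ sum g → ∀ i → f i ≡ g i
∑-rigid {suc n} {f} {g} f≤g eq = at
  where
  head≡ : f Fin.zero ≡ g Fin.zero
  head≡ = ≤-antisym (f≤g Fin.zero)
            (+-cancelʳ-≤ (sum (λ i → g (Fin.suc i))) _ _
              (≤-trans (≤-reflexive (sym eq)) (+-monoʳ-≤ (f Fin.zero) (∑-mono (λ i → f≤g (Fin.suc i))))))
  at : ∀ i → f i ≡ g i
  at Fin.zero    = head≡
  at (Fin.suc i) = ∑-rigid (λ j → f≤g (Fin.suc j)) (+-cancelˡ-≡ (f Fin.zero) _ _ (trans eq (cong (_+ _) (sym head≡)))) i

∑-const : ∀ n c → sum {n} (λ _ → c) ≡ n * c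
∑-const zero    c = refl
∑-const (suc n) c = cong (c +_) (∑-const n c)

∑-ones : ∀ n → sum {n} (λ _ → 1) ≡ n
∑-ones n = trans (∑-const n 1) (*-identityʳ n)

∑-split : ∀ m {n} (f : Fin (m + n) → ℕ) → sum f ≡ sum (λ i → f (i ↑ˡ n)) + sum (λ j → f (m ↑ʳ j))
∑-split zero    f = refl
∑-split (suc m) f = trans (cong (f Fin.zero +_) (∑-split m (λ i → f (Fin.suc i)))) (sym (+-assoc (f Fin.zero) _ _))

∑-positive : ∀ {n} (f : Fin n → ℕ) → 0 < sum f → ∃ λ i → 0 < f i
∑-positive {suc n} f pos with f Fin.zero in f₀
... | suc _ = Fin.zero , subst (0 <_) (sym f₀) (s≤s z≤n)
... | zero  with ∑-positive (f ∘ Fin.suc) pos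
...   | i , fᵢ = Fin.suc i , fᵢ

list-sum : ∀ n (f : Fin n → ℕ) → List.sum (map f (allFin n)) ≡ sum f
list-sum n f = trans (cong List.sum (map-tabulate (λ i → i) f)) (tabulate-sum n f)
  where
  tabulate-sum : ∀ n (f : Fin n → ℕ) → List.sum (tabulate f) ≡ sum f
  tabulate-sum zero    f = refl
  tabulate-sum (suc n) f = cong (f Fin.zero +_) (tabulate-sum n (λ i → f (Fin.suc i)))

below : ∀ {n} → (Fin n → Fin n → ℕ) → Fin n → Fin n → ℕ
below h u v = if toℕ u <ᵇ toℕ v then h u v else 0

pairSum : ∀ {n} → (Fin n → Fin n → ℕ) → ℕ
pairSum {n} h = sum (λ u → sum (λ v → below h u v))

wiener≡pairSum : ∀ {n} (G : Graph n) → wiener G ≡ pairSum (dist G)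
wiener≡pairSum {n} G = trans (list-sum n _) (sum-cong-≗ {n} (λ u → list-sum n _))

below-< : ∀ {n} (h : Fin n → Fin n → ℕ) {u v} → toℕ u < toℕ v → below h u v ≡ h u v
below-< h {u} {v} u<v with toℕ u <ᵇ toℕ v | <⇒<ᵇ u<v
... | true | _ = refl

below-mono : ∀ {n} {h₁ h₂ : Fin n → Fin n → ℕ} → (∀ u v → toℕ u < toℕ v → h₁ u v ≤ h₂ u v) →
             ∀ u v → below h₁ u v ≤ below h₂ u v
below-mono h₁≤h₂ u v with toℕ u <ᵇ toℕ v in lt
... | true  = h₁≤h₂ u v (<ᵇ⇒< (toℕ u) (toℕ v) (subst T (sym lt) _))
... | false = z≤n

pairSum-mono : ∀ {n} {h₁ h₂ : Fin n → Fin n → ℕ} → (∀ u v → toℕ u < toℕ v → h₁ u v ≤ h₂ u v) →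
               pairSum h₁ ≤ pairSum h₂
pairSum-mono h₁≤h₂ = ∑-mono (λ u → ∑-mono (below-mono h₁≤h₂ u))

pairSum-cong : ∀ {n} {h₁ h₂ : Fin n → Fin n → ℕ} → (∀ u v → toℕ u < toℕ v → h₁ u v ≡ h₂ u v) →
               pairSum h₁ ≡ pairSum h₂
pairSum-cong eq = ≤-antisym (pairSum-mono λ u v u<v → ≤-reflexive (eq u v u<v))
                            (pairSum-mono λ u v u<v → ≤-reflexive (sym (eq u v u<v)))

pairSum-rigid : ∀ {n} {h₁ h₂ : Fin n → Fin n → ℕ} → (∀ u v → toℕ u < toℕ v → h₁ u v ≤ h₂ u v) →
                pairSum h₁ ≡ pairSum h₂ → ∀ u v → toℕ u < toℕ v → h₁ u v ≡ h₂ u v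
pairSum-rigid {h₁ = h₁} {h₂} h₁≤h₂ eq u v u<v = begin
  h₁ u v         ≡⟨ below-< h₁ u<v ⟨
  below h₁ u v   ≡⟨ ∑-rigid (below-mono h₁≤h₂ u) rows v ⟩
  below h₂ u v   ≡⟨ below-< h₂ u<v ⟩
  h₂ u v         ∎
  where
  open ≡-Reasoning
  rows = ∑-rigid (λ u → ∑-mono (below-mono h₁≤h₂ u)) eq u

-- For symmetric h, the full double sum counts each pair twice plus the diagonal.
-- By induction on n: the first row (beyond the corner) and the first column have equal sums.
pairSum-double : ∀ {n} (h : Fin n → Fin n → ℕ) → (∀ u v → h u v ≡ h v u) →
                 2 * pairSum h + sum (λ u → h u u) ≡ sum (λ u → sum (λ v → h u v))
pairSum-double {zero}  h sym-h = refl
pairSum-double {suc n} h sym-h = begin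
  2 * (0 + row + pairSum h′) + (h₀₀ + diag′)
    ≡⟨ rearrange row (pairSum h′) h₀₀ diag′ ⟩
  (h₀₀ + row) + (row + (2 * pairSum h′ + diag′))
    ≡⟨ cong₂ (λ c r → (h₀₀ + row) + (c + r)) column (pairSum-double h′ (λ u v → sym-h _ _)) ⟩
  (h₀₀ + row) + (sum (λ u → h (Fin.suc u) Fin.zero) + sum (λ u → sum (h′ u)))
    ≡⟨ cong ((h₀₀ + row) +_) (∑-distrib-+ (λ u → h (Fin.suc u) Fin.zero) (λ u → sum (h′ u))) ⟨
  (h₀₀ + row) + sum (λ u → h (Fin.suc u) Fin.zero + sum (h′ u))
    ∎
  where
  open ≡-Reasoning
  h′ : Fin n → Fin n → ℕ
  h′ u v = h (Fin.suc u) (Fin.suc v)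
  h₀₀   = h Fin.zero Fin.zero
  row   = sum (λ v → h Fin.zero (Fin.suc v))
  diag′ = sum (λ u → h′ u u)
  column : row ≡ sum (λ u → h (Fin.suc u) Fin.zero)
  column = sum-cong-≗ (λ v → sym-h Fin.zero (Fin.suc v))
  rearrange : ∀ r p a d → 2 * (0 + r + p) + (a + d) ≡ (a + r) + (r + (2 * p + d))
  rearrange = solve-∀

reach-here : ∀ {n} (G : Graph n) v → reach G 0 v v ≡ true
reach-here G v = ⌊⌋-yes (v ≟ v) refl

reach-distinct : ∀ {n} (G : Graph n) {u v} → u ≢ v → reach G 0 u v ≡ false
reach-distinct G {u} {v} u≢v = ⌊⌋-no (u ≟ v) u≢v

reach-step : ∀ {n} (G : Graph n) {u w v} k → G u w ≡ true → reach G k w v ≡ true → reach G (suc k) u v ≡ true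
reach-step {n} G {u} {w} {v} k uw wv =
  trans (cong (reach G k u v ∨_) (any-intro (λ x → G u x ∧ reach G k x v) (∈-tabulate⁺ w) (cong₂ _∧_ uw wv)))
        (∨-zeroʳ (reach G k u v))

reach-edge : ∀ {n} (G : Graph n) {u v} → u ≢ v → reach G 1 u v ≡ true → G u v ≡ true
reach-edge {n} G {u} {v} u≢v walk = edge (any-elim viaNeighbour (allFin n) through-neighbour)
  where
  viaNeighbour : Fin n → Bool
  viaNeighbour x = G u x ∧ reach G 0 x v
  through-neighbour : any viaNeighbour (allFin n) ≡ true
  through-neighbour = trans (cong (_∨ any viaNeighbour (allFin n)) (sym (reach-distinct G u≢v))) walk
  -- The only vertex joined to v by a walk of length zero is v itself.
  edge : ∃ (λ x → viaNeighbour x ≡ true) → G u v ≡ true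
  edge (x , ux) with x ≟ v | G u x in uv
  ... | yes refl | true  = uv
  ... | yes refl | false = contradiction ux λ ()
  ... | no _     | true  = contradiction ux λ ()
  ... | no _     | false = contradiction ux λ ()

reach-no-edge : ∀ {n} (G : Graph n) {u v} → u ≢ v → G u v ≡ false → reach G 1 u v ≡ false
reach-no-edge G {u} {v} u≢v ¬uv with reach G 1 u v in walk
... | true  = contradiction (trans (sym (reach-edge G u≢v walk)) ¬uv) λ ()
... | false = refl

leastFrom-≥ : ∀ p s fuel → s ≤ leastFrom p s fuel
leastFrom-≥ p s zero = ≤-refl
leastFrom-≥ p s (suc fuel) with p s
... | true  = ≤-refl
... | false = ≤-trans (n≤1+n s) (leastFrom-≥ p (suc s) fuel)

leastFrom-skip : ∀ p s fuel → p s ≡ false → leastFrom p s (suc fuel) ≡ leastFrom p (suc s) fuel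
leastFrom-skip p s fuel ps rewrite ps = refl

leastFrom-hit : ∀ p s fuel → p s ≡ true → leastFrom p s (suc fuel) ≡ s
leastFrom-hit p s fuel ps rewrite ps = refl

dist-≥1 : ∀ {n} (G : Graph n) {u v} → u ≢ v → 1 ≤ dist G u v
dist-≥1 {n} G {u} {v} u≢v =
  subst (1 ≤_) (sym (leastFrom-skip (λ k → reach G k u v) 0 n (reach-distinct G u≢v))) (leastFrom-≥ _ 1 n)

dist-≥2 : ∀ {n} (G : Graph n) {u v} → u ≢ v → G u v ≡ false → 2 ≤ dist G u v
dist-≥2 {suc n} G {u} {v} u≢v ¬uv =
  subst (2 ≤_) (sym (trans (leastFrom-skip walk 0 (suc n) (reach-distinct G u≢v))
                           (leastFrom-skip walk 1 n (reach-no-edge G u≢v ¬uv))))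
        (leastFrom-≥ walk 2 n)
  where walk = λ k → reach G k u v

dist-edge : ∀ {n} (G : Graph n) {u v} → u ≢ v → G u v ≡ true → dist G u v ≡ 1
dist-edge {suc n} G {u} {v} u≢v uv =
  trans (leastFrom-skip walk 0 (suc n) (reach-distinct G u≢v))
        (leastFrom-hit walk 1 n (reach-step G 0 uv (reach-here G v)))
  where walk = λ k → reach G k u v

dist-common : ∀ {n} (G : Graph n) {u w v} → u ≢ v → G u v ≡ false → G u w ≡ true → G w v ≡ true →
              dist G u v ≡ 2
dist-common {suc zero} G {Fin.zero} {_} {Fin.zero} u≢v = contradiction refl u≢v
dist-common {suc (suc n)} G {u} {w} {v} u≢v ¬uv uw wv =
  trans (leastFrom-skip walk 0 (suc (suc n)) (reach-distinct G u≢v))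
  (trans (leastFrom-skip walk 1 (suc n) (reach-no-edge G u≢v ¬uv))
         (leastFrom-hit walk 2 n (reach-step G 1 uw (reach-step G 0 wv (reach-here G v)))))
  where walk = λ k → reach G k u v

module Classes {C : Set} (_≟ᶜ_ : DecidableEquality C) where

  count : ∀ {n} → (Fin n → C) → C → ℕ
  count κ c = sum (λ u → indicator ⌊ κ u ≟ᶜ c ⌋)

  count-permute : ∀ {n N} (π : Permutation n N) (κ : Fin N → C) c →
                  count (λ u → κ (π ⟨$⟩ʳ u)) c ≡ count κ c
  count-permute π κ c = sym (sum-permute (λ x → indicator ⌊ κ x ≟ᶜ c ⌋) π)

  count-self : ∀ {n} (κ : Fin (suc n) → C) → 0 < count κ (κ Fin.zero)
  count-self κ rewrite ⌊⌋-yes (κ Fin.zero ≟ᶜ κ Fin.zero) refl = s≤s z≤n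

  indicator-≟ : ∀ x c → 0 < indicator ⌊ x ≟ᶜ c ⌋ → x ≡ c
  indicator-≟ x c pos with x ≟ᶜ c
  ... | yes x≡c = x≡c

  -- Two class assignments with the same class sizes differ by a class-preserving permutation:
  -- send the first vertex to some w of its class and match the remaining vertices recursively.
  matching : ∀ {n N} (κ₁ : Fin n → C) (κ₂ : Fin N → C) → (∀ c → count κ₁ c ≡ count κ₂ c) →
             Σ (Permutation n N) λ π → ∀ u → κ₂ (π ⟨$⟩ʳ u) ≡ κ₁ u
  matching {zero}  {zero}  κ₁ κ₂ same = Perm.id , λ ()
  matching {zero}  {suc N} κ₁ κ₂ same = contradiction (same (κ₂ Fin.zero)) (<⇒≢ (count-self κ₂))
  matching {suc n} {zero}  κ₁ κ₂ same = contradiction (same (κ₁ Fin.zero)) (>⇒≢ (count-self κ₁))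
  matching {suc n} {suc N} κ₁ κ₂ same = π , preserves
    where
    a = κ₁ Fin.zero
    found = ∑-positive (λ x → indicator ⌊ κ₂ x ≟ᶜ a ⌋) (subst (0 <_) (same a) (count-self κ₁))
    w = proj₁ found
    κ₂w≡a : κ₂ w ≡ a
    κ₂w≡a = indicator-≟ (κ₂ w) a (proj₂ found)
    same′ : ∀ c → count (κ₁ ∘ Fin.suc) c ≡ count (κ₂ ∘ Fin.punchIn w) c
    same′ c = +-cancelˡ-≡ (indicator ⌊ a ≟ᶜ c ⌋) _ _ (begin
      count κ₁ c                               ≡⟨ same c ⟩
      count κ₂ c                               ≡⟨ sum-remove {i = w} (λ x → indicator ⌊ κ₂ x ≟ᶜ c ⌋) ⟩
      indicator ⌊ κ₂ w ≟ᶜ c ⌋ + count rest₂ c  ≡⟨ cong (λ x → indicator ⌊ x ≟ᶜ c ⌋ + count rest₂ c) κ₂w≡a ⟩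
      indicator ⌊ a ≟ᶜ c ⌋ + count rest₂ c     ∎)
      where
      open ≡-Reasoning
      rest₂ = κ₂ ∘ Fin.punchIn w
    rest = matching (κ₁ ∘ Fin.suc) (κ₂ ∘ Fin.punchIn w) same′
    π = Perm.insert Fin.zero w (proj₁ rest)
    preserves : ∀ u → κ₂ (π ⟨$⟩ʳ u) ≡ κ₁ u
    preserves Fin.zero    = κ₂w≡a
    preserves (Fin.suc u) = trans (cong κ₂ (Perm.insert-punchIn Fin.zero w (proj₁ rest) u)) (proj₂ rest u)

-- Roles: a vertex is deleted (K) or lies in one of the two colour classes (L, R).

data Role : Set where
  K L R : Role

_≟ᴿ_ : DecidableEquality Role
K ≟ᴿ K = yes refl
K ≟ᴿ L = no λ ()
K ≟ᴿ R = no λ ()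
L ≟ᴿ K = no λ ()
L ≟ᴿ L = yes refl
L ≟ᴿ R = no λ ()
R ≟ᴿ K = no λ ()
R ≟ᴿ L = no λ ()
R ≟ᴿ R = yes refl

open Classes _≟ᴿ_

is : Role → Role → ℕ
is c x = indicator ⌊ x ≟ᴿ c ⌋

sameSide : Role → Role → Bool
sameSide L L = true
sameSide R R = true
sameSide _ _ = false

sameSide-sym : ∀ x y → sameSide x y ≡ sameSide y x
sameSide-sym K K = refl
sameSide-sym K L = refl
sameSide-sym K R = refl
sameSide-sym L K = refl
sameSide-sym L L = refl
sameSide-sym L R = refl
sameSide-sym R K = refl
sameSide-sym R L = refl
sameSide-sym R R = refl

sameSide-indicator : ∀ x y → indicator (sameSide x y) ≡ is L x * is L y + is R x * is R y
sameSide-indicator K K = refl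
sameSide-indicator K L = refl
sameSide-indicator K R = refl
sameSide-indicator L K = refl
sameSide-indicator L L = refl
sameSide-indicator L R = refl
sameSide-indicator R K = refl
sameSide-indicator R L = refl
sameSide-indicator R R = refl

sameSide-self : ∀ x → indicator (sameSide x x) ≡ is L x + is R x
sameSide-self K = refl
sameSide-self L = refl
sameSide-self R = refl

is-partition : ∀ x → is K x + (is L x + is R x) ≡ 1
is-partition K = refl
is-partition L = refl
is-partition R = refl

sameSide-K : ∀ x → sameSide x K ≡ false
sameSide-K K = refl
sameSide-K L = refl
sameSide-K R = refl

count-partition : ∀ {n} (κ : Fin n → Role) → count κ K + (count κ L + count κ R) ≡ n
count-partition {n} κ = begin
  count κ K + (count κ L + count κ R)
    ≡⟨ cong (count κ K +_) (∑-distrib-+ (is L ∘ κ) (is R ∘ κ)) ⟨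
  count κ K + sum (λ u → is L (κ u) + is R (κ u))
    ≡⟨ ∑-distrib-+ (is K ∘ κ) _ ⟨
  sum (λ u → is K (κ u) + (is L (κ u) + is R (κ u)))
    ≡⟨ sum-cong-≗ (is-partition ∘ κ) ⟩
  sum {n} (λ _ → 1)
    ≡⟨ ∑-ones n ⟩
  n ∎
  where open ≡-Reasoning

-- The template graph of a role assignment: K_z ∨ (independent L ∨ independent R), where
-- two distinct vertices are adjacent unless they lie in the same colour class.
template : ∀ {n} → (Fin n → Role) → Graph n
template κ u v = not ⌊ u ≟ v ⌋ ∧ not (sameSide (κ u) (κ v))

templateDist : ∀ {n} → (Fin n → Role) → Fin n → Fin n → ℕ
templateDist κ u v = 1 + indicator (sameSide (κ u) (κ v))

templateDist-total : ∀ {n} (κ : Fin n → Role) →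
  sum (λ u → sum (λ v → templateDist κ u v)) ≡ n * n + (count κ L * count κ L + count κ R * count κ R)
templateDist-total {n} κ = begin
  sum (λ u → sum (λ v → templateDist κ u v))
    ≡⟨ sum-cong-≗ (λ u → sum-cong-≗ (λ v → cong suc (sameSide-indicator (κ u) (κ v)))) ⟩
  sum (λ u → sum (λ v → 1 + (ℓ u * ℓ v + r u * r v)))
    ≡⟨ sum-cong-≗ row ⟩
  sum (λ u → n + (ℓ u * p + r u * q))
    ≡⟨ trans (∑-distrib-+ (λ (_ : Fin n) → n) _) (cong (_+ sum (λ u → ℓ u * p + r u * q)) (∑-const n n)) ⟩
  n * n + sum (λ u → ℓ u * p + r u * q)
    ≡⟨ cong (n * n +_) (trans (∑-distrib-+ (λ u → ℓ u * p) _)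
                        (sym (cong₂ _+_ (*-distribʳ-sum p ℓ) (*-distribʳ-sum q r)))) ⟩
  n * n + (p * p + q * q)
    ∎
  where
  open ≡-Reasoning
  ℓ r : Fin n → ℕ
  ℓ = is L ∘ κ
  r = is R ∘ κ
  p = count κ L
  q = count κ R
  row : ∀ u → sum (λ v → 1 + (ℓ u * ℓ v + r u * r v)) ≡ n + (ℓ u * p + r u * q)
  row u = trans (∑-distrib-+ (λ (_ : Fin n) → 1) _)
    (cong₂ _+_ (∑-ones n)
      (trans (∑-distrib-+ (λ v → ℓ u * ℓ v) _)
        (sym (cong₂ _+_ (*-distribˡ-sum (ℓ u) ℓ) (*-distribˡ-sum (r u) r)))))

templateDist-pairSum : ∀ {n} (κ : Fin n → Role) →
  2 * pairSum (templateDist κ) + (n + (count κ L + count κ R))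
    ≡ n * n + (count κ L * count κ L + count κ R * count κ R)
templateDist-pairSum {n} κ = begin
  2 * pairSum (templateDist κ) + (n + (count κ L + count κ R))
    ≡⟨ cong (2 * pairSum (templateDist κ) +_) diagonal ⟨
  2 * pairSum (templateDist κ) + sum (λ u → templateDist κ u u)
    ≡⟨ pairSum-double (templateDist κ) (λ u v → cong suc (cong indicator (sameSide-sym (κ u) (κ v)))) ⟩
  sum (λ u → sum (λ v → templateDist κ u v))
    ≡⟨ templateDist-total κ ⟩
  n * n + (count κ L * count κ L + count κ R * count κ R)
    ∎
  where
  open ≡-Reasoning
  diagonal : sum (λ u → templateDist κ u u) ≡ n + (count κ L + count κ R)
  diagonal = begin
    sum (λ u → 1 + indicator (sameSide (κ u) (κ u)))  ≡⟨ ∑-distrib-+ (λ (_ : Fin n) → 1) _ ⟩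
    sum {n} (λ _ → 1) + sum (λ u → indicator (sameSide (κ u) (κ u)))
      ≡⟨ cong₂ _+_ (∑-ones n)
                   (trans (sum-cong-≗ (sameSide-self ∘ κ)) (∑-distrib-+ (is L ∘ κ) (is R ∘ κ))) ⟩
    n + (count κ L + count κ R)                       ∎

template-simple : ∀ {n} (κ : Fin n → Role) → IsSimple (template κ)
template-simple κ = record
  { symmetric   = λ u v → cong₂ (λ b c → not b ∧ not c) (⌊≟⌋-sym u v) (sameSide-sym (κ u) (κ v))
  ; irreflexive = λ u → cong (λ b → not b ∧ _) (⌊⌋-yes (u ≟ u) refl)
  }

template-off-diagonal : ∀ {n} (κ : Fin n → Role) {u v} → u ≢ v → template κ u v ≡ not (sameSide (κ u) (κ v))
template-off-diagonal κ {u} {v} u≢v = cong (λ b → not b ∧ _) (⌊⌋-no (u ≟ v) u≢v)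

<⇒≢ᶠ : ∀ {n} {u v : Fin n} → toℕ u < toℕ v → u ≢ v
<⇒≢ᶠ u<v refl = <-irrefl refl u<v

simple-ext : ∀ {n} {G H : Graph n} → IsSimple G → IsSimple H →
             (∀ u v → toℕ u < toℕ v → G u v ≡ H u v) → ∀ u v → G u v ≡ H u v
simple-ext simple-G simple-H agree u v with <-cmp (toℕ u) (toℕ v)
... | tri< u<v _ _ = agree u v u<v
... | tri≈ _ u≡v _ rewrite toℕ-injective u≡v =
  trans (IsSimple.irreflexive simple-G v) (sym (IsSimple.irreflexive simple-H v))
... | tri> _ _ v<u =
  trans (IsSimple.symmetric simple-G u v) (trans (agree v u v<u) (IsSimple.symmetric simple-H v u))

Fits : ∀ {n} → Graph n → (Fin n → Role) → Set
Fits G κ = ∀ u v → G u v ≡ true → sameSide (κ u) (κ v) ≡ false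

templateDist≤dist : ∀ {n} {G : Graph n} {κ} → Fits G κ → ∀ {u v} → u ≢ v → templateDist κ u v ≤ dist G u v
templateDist≤dist {G = G} {κ} fits {u} {v} u≢v with sameSide (κ u) (κ v) in same | G u v in uv
... | false | _     = dist-≥1 G u≢v
... | true  | false = dist-≥2 G u≢v uv
... | true  | true  = contradiction (trans (sym same) (fits u v uv)) λ ()

template≤wiener : ∀ {n} {G : Graph n} {κ} → Fits G κ → pairSum (templateDist κ) ≤ wiener G
template≤wiener {G = G} fits =
  subst (_ ≤_) (sym (wiener≡pairSum G)) (pairSum-mono λ u v u<v → templateDist≤dist fits (<⇒≢ᶠ u<v))

template-from-distances : ∀ {n} {G : Graph n} {κ} → IsSimple G → Fits G κ →
  (∀ u v → toℕ u < toℕ v → dist G u v ≡ templateDist κ u v) → ∀ u v → G u v ≡ template κ u v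
template-from-distances {G = G} {κ} simple fits dists = simple-ext simple (template-simple κ) agree
  where
  agree : ∀ u v → toℕ u < toℕ v → G u v ≡ template κ u v
  agree u v u<v = trans (side u v u<v) (sym (template-off-diagonal κ (<⇒≢ᶠ u<v)))
    where
    side : ∀ u v → toℕ u < toℕ v → G u v ≡ not (sameSide (κ u) (κ v))
    side u v u<v with sameSide (κ u) (κ v) in same | G u v in uv
    ... | false | true  = refl
    ... | true  | false = refl
    ... | true  | true  = contradiction (trans (sym same) (fits u v uv)) λ ()
    ... | false | false = contradiction (≤-trans (dist-≥2 G (<⇒≢ᶠ u<v) uv) (≤-reflexive dist≡1)) λ { (s≤s ()) }
      where
      dist≡1 : dist G u v ≡ 1
      dist≡1 = trans (dists u v u<v) (cong (λ b → 1 + indicator b) same)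

template-of-tight : ∀ {n} {G : Graph n} {κ} → IsSimple G → Fits G κ →
                    wiener G ≡ pairSum (templateDist κ) → ∀ u v → G u v ≡ template κ u v
template-of-tight {G = G} simple fits W≡T = template-from-distances simple fits λ u v u<v →
  sym (pairSum-rigid (λ x y x<y → templateDist≤dist fits (<⇒≢ᶠ x<y))
                     (trans (sym W≡T) (wiener≡pairSum G)) u v u<v)

template-adjacency : ∀ {n} {G : Graph n} {κ} → (∀ u v → G u v ≡ template κ u v) →
                     ∀ {u v} → u ≢ v → G u v ≡ not (sameSide (κ u) (κ v))
template-adjacency {κ = κ} G≗ {u} {v} u≢v = trans (G≗ u v) (template-off-diagonal κ u≢v)

-- In a graph equal to a template with a deleted vertex w, distances are the template distances:
-- vertices of one colour class have w as a common neighbour.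
dist-template : ∀ {n} {G : Graph n} {κ w} → (∀ u v → G u v ≡ template κ u v) → κ w ≡ K →
                ∀ {u v} → u ≢ v → dist G u v ≡ templateDist κ u v
dist-template {G = G} {κ} {w} G≗ κw≡K {u} {v} u≢v with sameSide (κ u) (κ v) in same
... | false = dist-edge G u≢v (trans (template-adjacency G≗ u≢v) (cong not same))
... | true  = dist-common G u≢v (trans (template-adjacency G≗ u≢v) (cong not same))
                (trans (template-adjacency G≗ u≢w) (cong not (side-K (κ u))))
                (trans (template-adjacency G≗ w≢v) (cong not (K-side (κ v))))
  where
  K-side : ∀ x → sameSide (κ w) x ≡ false
  K-side x = cong (λ y → sameSide y x) κw≡K
  side-K : ∀ x → sameSide x (κ w) ≡ false
  side-K x = trans (cong (sameSide x) κw≡K) (sameSide-K x)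
  u≢w : u ≢ w
  u≢w refl = contradiction (trans (sym same) (K-side (κ v))) λ ()
  w≢v : w ≢ v
  w≢v refl = contradiction (trans (sym same) (side-K (κ u))) λ ()

⟨$⟩ʳ-injective : ∀ {n N} (π : Permutation n N) {u v} → π ⟨$⟩ʳ u ≡ π ⟨$⟩ʳ v → u ≡ v
⟨$⟩ʳ-injective π {u} {v} eq =
  trans (sym (Perm.inverseˡ π)) (trans (cong (π ⟨$⟩ˡ_) eq) (Perm.inverseˡ π))

template-permute : ∀ {n N} (π : Permutation n N) (κ₁ : Fin n → Role) (κ₂ : Fin N → Role) →
  (∀ u → κ₂ (π ⟨$⟩ʳ u) ≡ κ₁ u) → ∀ u v → template κ₂ (π ⟨$⟩ʳ u) (π ⟨$⟩ʳ v) ≡ template κ₁ u v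
template-permute π κ₁ κ₂ preserves u v =
  cong₂ (λ b c → not b ∧ not c) (⌊≟⌋-injective (π ⟨$⟩ʳ_) (⟨$⟩ʳ-injective π) u v)
                                (cong₂ sameSide (preserves u) (preserves v))

template-iso : ∀ {n N} {G : Graph n} {H : Graph N} {κ₁ κ₂} →
  (∀ u v → G u v ≡ template κ₁ u v) → (∀ u v → H u v ≡ template κ₂ u v) →
  (∀ c → count κ₁ c ≡ count κ₂ c) → G ≅ H
template-iso {κ₁ = κ₁} {κ₂} G≗ H≗ same = ↔⇒⤖ π , λ u v →
  trans (G≗ u v) (trans (sym (template-permute π κ₁ κ₂ preserves u v)) (sym (H≗ _ _)))
  where
  π = proj₁ (matching κ₁ κ₂ same)
  preserves = proj₂ (matching κ₁ κ₂ same)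

iso-template : ∀ {n N} {G : Graph n} {H : Graph N} {κ} → G ≅ H → (∀ u v → H u v ≡ template κ u v) →
  Σ (Fin n → Role) λ κ′ → (∀ u v → G u v ≡ template κ′ u v) × (∀ c → count κ′ c ≡ count κ c)
iso-template {G = G} {H} {κ} (f , G≅H) H≗ = κ′ , G≗ , count-permute π κ
  where
  π = ⤖⇒↔ f
  κ′ : Fin _ → Role
  κ′ u = κ (π ⟨$⟩ʳ u)
  G≗ : ∀ u v → G u v ≡ template κ′ u v
  G≗ u v = trans (G≅H u v) (trans (H≗ _ _) (template-permute π κ′ κ (λ _ → refl) u v))

extremalRoles : ∀ m a b → Fin (m + (a + b)) → Role
extremalRoles m a b = (λ (_ : Fin m) → K) ++ ((λ (_ : Fin a) → L) ++ (λ (_ : Fin b) → R))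

-- Joining two templates whose classes never share a colour class gives a template:
-- inside a block equality tests are transported along the block embedding, across
-- the blocks all pairs are adjacent.
join-template : ∀ {a b} {G : Graph a} {H : Graph b} {κ₁ κ₂} →
  (∀ u v → G u v ≡ template κ₁ u v) → (∀ u v → H u v ≡ template κ₂ u v) →
  (∀ x y → sameSide (κ₁ x) (κ₂ y) ≡ false) → ∀ u v → join G H u v ≡ template (κ₁ ++ κ₂) u v
join-template {a} {b} {κ₁ = κ₁} {κ₂} G≗ H≗ apart u v with splitAt a u in eu | splitAt a v in ev
... | inj₁ x | inj₁ y = trans (G≗ x y) (cong (λ c → not c ∧ not (sameSide (κ₁ x) (κ₁ y)))
        (trans (sym (⌊≟⌋-injective (_↑ˡ b) (↑ˡ-injective b _ _) x y))
               (cong₂ (λ s t → ⌊ s ≟ t ⌋) (splitAt⁻¹-↑ˡ eu) (splitAt⁻¹-↑ˡ ev))))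
... | inj₂ x | inj₂ y = trans (H≗ x y) (cong (λ c → not c ∧ not (sameSide (κ₂ x) (κ₂ y)))
        (trans (sym (⌊≟⌋-injective (a ↑ʳ_) (↑ʳ-injective a _ _) x y))
               (cong₂ (λ s t → ⌊ s ≟ t ⌋) (splitAt⁻¹-↑ʳ eu) (splitAt⁻¹-↑ʳ ev))))
... | inj₁ x | inj₂ y = sym (cong₂ (λ c d → not c ∧ not d)
        (⌊⌋-no (u ≟ v) λ { refl → inj₁≢inj₂ (trans (sym eu) ev) })
        (apart x y))
... | inj₂ x | inj₁ y = sym (cong₂ (λ c d → not c ∧ not d)
        (⌊⌋-no (u ≟ v) λ { refl → inj₁≢inj₂ (trans (sym ev) eu) })
        (trans (sameSide-sym (κ₂ x) (κ₁ y)) (apart y x)))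

complete-template : ∀ m u v → complete m u v ≡ template (λ (_ : Fin m) → K) u v
complete-template m u v = sym (∧-identityʳ (not ⌊ u ≟ v ⌋))

edgeless-template : ∀ r c → sameSide c c ≡ true → ∀ u v → edgeless r u v ≡ template (λ (_ : Fin r) → c) u v
edgeless-template r c same u v rewrite same = sym (∧-zeroʳ (not ⌊ u ≟ v ⌋))

extremal-template : ∀ m a b u v →
  join (complete m) (join (edgeless a) (edgeless b)) u v ≡ template (extremalRoles m a b) u v
extremal-template m a b = join-template (complete-template m)
  (join-template (edgeless-template a L refl) (edgeless-template b R refl) λ _ _ → refl)
  λ _ _ → refl

count-const : ∀ n x c → count (λ (_ : Fin n) → x) c ≡ n * is c x
count-const n x c = ∑-const n (is c x)

count-++ : ∀ {a b} (κ₁ : Fin a → Role) (κ₂ : Fin b → Role) c → count (κ₁ ++ κ₂) c ≡ count κ₁ c + count κ₂ c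
count-++ {a} κ₁ κ₂ c = trans (∑-split a (is c ∘ (κ₁ ++ κ₂)))
  (cong₂ _+_ (sum-cong-≗ (cong (is c) ∘ lookup-++ˡ κ₁ κ₂)) (sum-cong-≗ (cong (is c) ∘ lookup-++ʳ κ₁ κ₂)))

extremal-count : ∀ m a b c → count (extremalRoles m a b) c ≡ m * is c K + (a * is c L + b * is c R)
extremal-count m a b c =
  trans (count-++ (λ (_ : Fin m) → K) ((λ (_ : Fin a) → L) ++ (λ (_ : Fin b) → R)) c)
    (cong₂ _+_ (count-const m K c)
      (trans (count-++ (λ (_ : Fin a) → L) (λ (_ : Fin b) → R) c)
        (cong₂ _+_ (count-const a L c) (count-const b R c))))

extremal-sizes : ∀ m a b → count (extremalRoles m a b) K ≡ m × count (extremalRoles m a b) L ≡ a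
                                                      × count (extremalRoles m a b) R ≡ b
extremal-sizes m a b = trans (extremal-count m a b K) (sizeK m a b)
                     , trans (extremal-count m a b L) (sizeL m a b)
                     , trans (extremal-count m a b R) (sizeR m a b)
  where
  sizeK : ∀ m a b → m * 1 + (a * 0 + b * 0) ≡ m
  sizeK = solve-∀
  sizeL : ∀ m a b → m * 0 + (a * 1 + b * 0) ≡ a
  sizeL = solve-∀
  sizeR : ∀ m a b → m * 0 + (a * 0 + b * 1) ≡ b
  sizeR = solve-∀

extremal-iso : ∀ {n} {G : Graph n} {κ} m a b → (∀ u v → G u v ≡ template κ u v) →
  count κ K ≡ m → count κ L ≡ a → count κ R ≡ b → G ≅ join (complete m) (join (edgeless a) (edgeless b))
extremal-iso {κ = κ} m a b G≗ sizeK sizeL sizeR = template-iso G≗ (extremal-template m a b) same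
  where
  sizes = extremal-sizes m a b
  same : ∀ c → count κ c ≡ count (extremalRoles m a b) c
  same K = trans sizeK (sym (proj₁ sizes))
  same L = trans sizeL (sym (proj₁ (proj₂ sizes)))
  same R = trans sizeR (sym (proj₂ (proj₂ sizes)))

roles : ∀ {n} → Subset n → (Fin n → Bool) → Fin n → Role
roles S c u = if lookup S u then K else (if c u then L else R)

ProperOutside : ∀ {n} → Graph n → Subset n → (Fin n → Bool) → Set
ProperOutside G S c = ∀ u v → u ∉ S → v ∉ S → G u v ≡ true → c u ≢ c v

∉-lookup : ∀ {n} (S : Subset n) {u} → lookup S u ≡ false → u ∉ S
∉-lookup S su u∈S = contradiction (trans (sym su) ([]=⇒lookup u∈S)) λ ()

roles-fit : ∀ {n} {G : Graph n} {S c} → ProperOutside G S c → Fits G (roles S c)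
roles-fit {S = S} {c} proper u v uv with lookup S u in su | lookup S v in sv
... | true  | _    = refl
... | false | true = sameSide-K (if c u then L else R)
... | false | false with c u in cu | c v in cv
...   | true  | false = refl
...   | false | true  = refl
...   | true  | true  = contradiction (trans cu (sym cv)) (proper u v (∉-lookup S su) (∉-lookup S sv) uv)
...   | false | false = contradiction (trans cu (sym cv)) (proper u v (∉-lookup S su) (∉-lookup S sv) uv)

count-deleted : ∀ {n} (S : Subset n) c → count (roles S c) K ≡ ∣ S ∣
count-deleted []          c = refl
count-deleted (true ∷ S)  c = cong suc (count-deleted S (c ∘ Fin.suc))
count-deleted (false ∷ S) c = trans (cong (_+ count (roles S (c ∘ Fin.suc)) K) (coloured (c Fin.zero)))
                                    (count-deleted S (c ∘ Fin.suc))
  where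
  coloured : ∀ b → is K (if b then L else R) ≡ 0
  coloured true  = refl
  coloured false = refl

swap : Role → Role
swap K = K
swap L = R
swap R = L

is-swap : ∀ c x → is c (swap x) ≡ is (swap c) x
is-swap K K = refl
is-swap K L = refl
is-swap K R = refl
is-swap L K = refl
is-swap L L = refl
is-swap L R = refl
is-swap R K = refl
is-swap R L = refl
is-swap R R = refl

count-complement : ∀ {n} (S : Subset n) c x → count (roles S (not ∘ c)) x ≡ count (roles S c) (swap x)
count-complement S c x = sum-cong-≗ λ u → trans (cong (is x) (complement u)) (is-swap x (roles S c u))
  where
  complement : ∀ u → roles S (not ∘ c) u ≡ swap (roles S c u)
  complement u with lookup S u | c u
  ... | true  | _     = refl
  ... | false | true  = refl
  ... | false | false = refl

balanced-roles : ∀ {n} {G : Graph n} {m} → VertexBipartitenessAtMost G m →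
  Σ (Fin n → Role) λ κ → Fits G κ × count κ K ≤ m × count κ R ≤ count κ L
balanced-roles {G = G} {m} (S , |S|≤m , c , proper) with count (roles S c) R ≤? count (roles S c) L
... | yes R≤L = roles S c , roles-fit proper , subst (_≤ m) (sym (count-deleted S c)) |S|≤m , R≤L
... | no  R≰L = roles S (not ∘ c)
              , roles-fit (λ u v u∉S v∉S uv → proper u v u∉S v∉S uv ∘ not-injective)
              , subst (_≤ m) (sym (count-deleted S (not ∘ c))) |S|≤m
              , subst₂ _≤_ (sym (count-complement S c R)) (sym (count-complement S c L)) (<⇒≤ (≰⇒> R≰L))

colour-total : ∀ {n m z p q} e r → m ≡ z + e → n ≡ m + r → z + (p + q) ≡ n → p + q ≡ e + r
colour-total {z = z} e r refl refl partition = +-cancelˡ-≡ z _ _ (trans partition (+-assoc z e r))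

-- The template Wiener sum exceeds the claimed bound by e·(2 + 2s + e) + d², where
-- e = m − z counts unused deletions and d = p − q is the colour-class imbalance.
excess-identity : ∀ {n m z p q T} e d s → m ≡ z + e → p ≡ q + d → n ≡ m + (2 + s) → p + q ≡ e + (2 + s) →
  2 * T + (n + (p + q)) ≡ n * n + (p * p + q * q) →
  4 * T + 2 * m * n + 4 * n ≡ 3 * n * n + m * m + 2 * m + (e * (2 + 2 * s + e) + d * d)
excess-identity {z = z} {q = q} {T} e d s refl refl refl half key =
  +-cancelʳ-≡ (2 * (n + (e + r))) _ _ (begin
    4 * T + 2 * m * n + 4 * n + 2 * (n + (e + r))
      ≡⟨ cong (λ t → 4 * T + 2 * m * n + 4 * n + 2 * (n + t)) half ⟨
    4 * T + 2 * m * n + 4 * n + 2 * (n + (p + q))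
      ≡⟨ doubled T m n (p + q) ⟩
    2 * (2 * T + (n + (p + q))) + 2 * m * n + 4 * n
      ≡⟨ cong (λ t → 2 * t + 2 * m * n + 4 * n) key ⟩
    2 * (n * n + (p * p + q * q)) + 2 * m * n + 4 * n
      ≡⟨ squares n m q d ⟩
    2 * n * n + ((p + q) * (p + q) + d * d) + 2 * m * n + 4 * n
      ≡⟨ cong (λ t → 2 * n * n + (t * t + d * d) + 2 * m * n + 4 * n) half ⟩
    2 * n * n + ((e + r) * (e + r) + d * d) + 2 * m * n + 4 * n
      ≡⟨ expand z e s d ⟩
    3 * n * n + m * m + 2 * m + (e * (2 + 2 * s + e) + d * d) + 2 * (n + (e + r))
      ∎)
  where
  open ≡-Reasoning
  r = 2 + s
  m = z + e
  n = m + r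
  p = q + d
  doubled : ∀ T m n t → 4 * T + 2 * m * n + 4 * n + 2 * (n + t) ≡ 2 * (2 * T + (n + t)) + 2 * m * n + 4 * n
  doubled = solve-∀
  squares : ∀ n m q d → 2 * (n * n + ((q + d) * (q + d) + q * q)) + 2 * m * n + 4 * n
                        ≡ 2 * n * n + (((q + d) + q) * ((q + d) + q) + d * d) + 2 * m * n + 4 * n
  squares = solve-∀
  expand : ∀ z e s d →
    let m = z + e ; n = m + (2 + s) in
    2 * n * n + ((e + (2 + s)) * (e + (2 + s)) + d * d) + 2 * m * n + 4 * n
      ≡ 3 * n * n + m * m + 2 * m + (e * (2 + 2 * s + e) + d * d) + 2 * (n + (e + (2 + s)))
  expand = solve-∀

squeeze : ∀ {A T W X} b c → T ≤ W → 4 * T + b + c ≡ A + X →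
          (A ≤ 4 * W + b + c) × (4 * W + b + c ≡ A → X ≡ 0 × W ≡ T)
squeeze {A} {T} {W} {X} b c T≤W identity = A≤ , tight
  where
  scaled : 4 * T + b + c ≤ 4 * W + b + c
  scaled = +-monoˡ-≤ c (+-monoˡ-≤ b (*-monoʳ-≤ 4 T≤W))
  A+X≤ : A + X ≤ 4 * W + b + c
  A+X≤ = subst (_≤ 4 * W + b + c) identity scaled
  A≤ : A ≤ 4 * W + b + c
  A≤ = ≤-trans (m≤m+n A X) A+X≤
  tight : 4 * W + b + c ≡ A → X ≡ 0 × W ≡ T
  tight eq = X≡0 , sym (*-cancelˡ-≡ T W 4 (+-cancelʳ-≡ b _ _ (+-cancelʳ-≡ c _ _ (begin
    4 * T + b + c  ≡⟨ identity ⟩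
    A + X          ≡⟨ cong (A +_) X≡0 ⟩
    A + 0          ≡⟨ +-identityʳ A ⟩
    A              ≡⟨ eq ⟨
    4 * W + b + c  ∎))))
    where
    open ≡-Reasoning
    X≡0 : X ≡ 0
    X≡0 = n≤0⇒n≡0 (+-cancelˡ-≤ A X 0 (subst (A + X ≤_) (trans eq (sym (+-identityʳ A))) A+X≤))

double-injective : ∀ a b → a + a ≡ b + b → a ≡ b
double-injective zero    zero    _  = refl
double-injective (suc a) (suc b) eq =
  cong suc (double-injective a b (suc-injective (trans (sym (+-suc a a)) (trans (suc-injective eq) (+-suc b b)))))

double≢odd : ∀ a b → a + a ≢ suc (b + b)
double≢odd (suc a) zero    eq = 0≢1+n (sym (trans (sym (+-suc a a)) (suc-injective eq)))
double≢odd (suc a) (suc b) eq =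
  double≢odd a b (suc-injective (suc-injective (trans (cong suc (sym (+-suc a a))) (trans eq (cong (2 +_) (+-suc b b))))))

even-excess : ∀ {p q} e d s k → p ≡ q + d → p + q ≡ e + (2 + s) → 2 + s ≡ k + k →
              e * (2 + 2 * s + e) + d * d ≡ 0 → e ≡ 0 × p ≡ k × q ≡ k
even-excess {q = q} e d s k refl half even X≡0 = e≡0 , trans (cong (q +_) d≡0) (trans (+-identityʳ q) q≡k) , q≡k
  where
  e≡0 : e ≡ 0
  e≡0 = m*n≡0⇒m≡0 e (2 + 2 * s + e) (m+n≡0⇒m≡0 _ X≡0)
  d≡0 : d ≡ 0
  d≡0 = reduce (m*n≡0⇒m≡0∨n≡0 d (m+n≡0⇒n≡0 (e * (2 + 2 * s + e)) X≡0))
  q≡k : q ≡ k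
  q≡k = double-injective q k (begin
    q + q            ≡⟨ cong (_+ q) (+-identityʳ q) ⟨
    (q + 0) + q      ≡⟨ cong (λ t → q + t + q) d≡0 ⟨
    (q + d) + q      ≡⟨ half ⟩
    e + (2 + s)      ≡⟨ cong (_+ (2 + s)) e≡0 ⟩
    2 + s            ≡⟨ even ⟩
    k + k            ∎)
    where open ≡-Reasoning

odd-excess : ∀ {p q} e d s k → p ≡ q + d → p + q ≡ e + (2 + s) → 2 + s ≡ suc k + k →
  Σ ℕ λ X′ → (e * (2 + 2 * s + e) + d * d ≡ suc X′) × (X′ ≡ 0 → e ≡ 0 × p ≡ suc k × q ≡ k)
odd-excess (suc e) d             s k refl half odd = _ , refl , λ ()
odd-excess {q = q} zero zero     s k refl half odd =
  contradiction (trans (cong (_+ q) (sym (+-identityʳ q))) (trans half odd)) (double≢odd q k)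
odd-excess {q = q} zero (suc zero) s k refl half odd =
  0 , refl , λ _ → refl , trans (+-comm q 1) (cong suc q≡k) , q≡k
  where
  q≡k : q ≡ k
  q≡k = double-injective q k (suc-injective (trans (cong (_+ q) (+-comm 1 q)) (trans half odd)))
odd-excess zero (suc (suc d))    s k refl half odd = _ , refl , λ ()

extremal-wiener : ∀ {n} {G : Graph n} {m a b} d s → 1 ≤ m → a ≡ b + d → n ≡ m + (2 + s) →
  G ≅ join (complete m) (join (edgeless a) (edgeless b)) →
  4 * wiener G + 2 * m * n + 4 * n ≡ 3 * n * n + m * m + 2 * m + d * d
extremal-wiener {n} {G} {m} {a} {b} d s 1≤m a≡b+d n≡ G≅ =
  excess-identity {T = wiener G} 0 d s (sym (+-identityʳ m)) a≡b+d n≡ colours key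
  where
  transported = iso-template G≅ (extremal-template m a b)
  κ = proj₁ transported
  sizes = extremal-sizes m a b
  sizeK : count κ K ≡ m
  sizeK = trans (proj₂ (proj₂ transported) K) (proj₁ sizes)
  sizeL : count κ L ≡ a
  sizeL = trans (proj₂ (proj₂ transported) L) (proj₁ (proj₂ sizes))
  sizeR : count κ R ≡ b
  sizeR = trans (proj₂ (proj₂ transported) R) (proj₂ (proj₂ sizes))
  -- Since m ≥ 1 there is a deleted vertex, a common neighbour of each colour class.
  deleted = ∑-positive (is K ∘ κ) (subst (0 <_) (sym sizeK) 1≤m)
  W≡T : wiener G ≡ pairSum (templateDist κ)
  W≡T = trans (wiener≡pairSum G) (pairSum-cong λ u v u<v →
          dist-template (proj₁ (proj₂ transported)) (indicator-≟ _ K (proj₂ deleted)) (<⇒≢ᶠ u<v))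
  colours : a + b ≡ 0 + (2 + s)
  colours = colour-total {p = a} {q = b} 0 (2 + s) (sym (+-identityʳ m)) n≡
              (trans (sym (cong₂ _+_ sizeK (cong₂ _+_ sizeL sizeR))) (count-partition κ))
  key : 2 * wiener G + (n + (a + b)) ≡ n * n + (a * a + b * b)
  key = begin
    2 * wiener G + (n + (a + b))
      ≡⟨ cong₂ (λ t x → 2 * t + (n + x)) W≡T (sym (cong₂ _+_ sizeL sizeR)) ⟩
    2 * pairSum (templateDist κ) + (n + (count κ L + count κ R))
      ≡⟨ templateDist-pairSum κ ⟩
    n * n + (count κ L * count κ L + count κ R * count κ R)
      ≡⟨ cong₂ (λ x y → n * n + (x * x + y * y)) sizeL sizeR ⟩
    n * n + (a * a + b * b)
      ∎
    where open ≡-Reasoning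

record ExcessWitness {n : ℕ} (G : Graph n) (m s : ℕ) : Set where
  field
    κ          : Fin n → Role
    fits       : Fits G κ
    e d        : ℕ
    slack      : m ≡ count κ K + e
    imbalance  : count κ L ≡ count κ R + d
    colours    : count κ L + count κ R ≡ e + (2 + s)
    template≤W : pairSum (templateDist κ) ≤ wiener G
    identity   : 4 * pairSum (templateDist κ) + 2 * m * n + 4 * n
                   ≡ 3 * n * n + m * m + 2 * m + (e * (2 + 2 * s + e) + d * d)

excess-witness : ∀ {n} {G : Graph n} {m} s → n ≡ m + (2 + s) → VertexBipartitenessAtMost G m →
                 ExcessWitness G m s
excess-witness {n} {G} {m} s n≡ v₂≤m = record
  { κ = κ ; fits = fits ; e = e ; d = d ; slack = slack ; imbalance = imbalance ; colours = colours
  ; template≤W = template≤wiener {κ = κ} fits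
  ; identity   = excess-identity {T = pairSum (templateDist κ)} e d s slack imbalance n≡ colours
                   (templateDist-pairSum κ)
  }
  where
  balanced = balanced-roles v₂≤m
  κ = proj₁ balanced
  fits = proj₁ (proj₂ balanced)
  unused = m≤n⇒∃[o]m+o≡n (proj₁ (proj₂ (proj₂ balanced)))
  excess = m≤n⇒∃[o]m+o≡n (proj₂ (proj₂ (proj₂ balanced)))
  e = proj₁ unused
  slack = sym (proj₂ unused)
  d = proj₁ excess
  imbalance = sym (proj₂ excess)
  colours = colour-total {p = count κ L} {q = count κ R} e (2 + s) slack n≡ (count-partition κ)

-- Corollary 4.1, with the bound multiplied by 4: the even and odd cases of n − m.
corollary4p1 : ∀ (n m : ℕ) → 1 ≤ m → m + 2 ≤ n →
    (G : Graph n) → IsSimple G → Connected G →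
    VertexBipartitenessAtMost G m →
    (∀ (k : ℕ) → n ≡ m + (k + k) →
      (3 * n * n + m * m + 2 * m ≤ 4 * wiener G + 2 * m * n + 4 * n)
      × ((4 * wiener G + 2 * m * n + 4 * n ≡ 3 * n * n + m * m + 2 * m)
          → G ≅ join (complete m) (join (edgeless k) (edgeless k)))
      × (G ≅ join (complete m) (join (edgeless k) (edgeless k))
          → 4 * wiener G + 2 * m * n + 4 * n ≡ 3 * n * n + m * m + 2 * m))
    × (∀ (k : ℕ) → n ≡ m + (suc k + k) →
      (3 * n * n + m * m + 2 * m + 1 ≤ 4 * wiener G + 2 * m * n + 4 * n)
      × ((4 * wiener G + 2 * m * n + 4 * n ≡ 3 * n * n + m * m + 2 * m + 1)
          → G ≅ join (complete m) (join (edgeless (suc k)) (edgeless k)))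
      × (G ≅ join (complete m) (join (edgeless (suc k)) (edgeless k))
          → 4 * wiener G + 2 * m * n + 4 * n ≡ 3 * n * n + m * m + 2 * m + 1))
corollary4p1 n m 1≤m m+2≤n G simple _ v₂≤m = even , odd
  where
  gap = m≤n⇒∃[o]m+o≡n m+2≤n
  s = proj₁ gap
  n≡ : n ≡ m + (2 + s)
  n≡ = trans (sym (proj₂ gap)) (+-assoc m 2 s)
  open ExcessWitness (excess-witness s n≡ v₂≤m)
  A₀ = 3 * n * n + m * m + 2 * m
  gap≡ : ∀ {r} → n ≡ m + r → 2 + s ≡ r
  gap≡ n≡′ = +-cancelˡ-≡ m _ _ (trans (sym n≡) n≡′)
  extremal : e ≡ 0 → wiener G ≡ pairSum (templateDist κ) → ∀ {a b} → count κ L ≡ a → count κ R ≡ b →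
             G ≅ join (complete m) (join (edgeless a) (edgeless b))
  extremal e≡0 W≡T = extremal-iso m _ _ (template-of-tight simple fits W≡T)
    (trans (sym (+-identityʳ _)) (trans (cong (count κ K +_) (sym e≡0)) (sym slack)))

  even = λ k n≡′ → let sq = squeeze (2 * m * n) (4 * n) template≤W identity in
    proj₁ sq
    , (λ tight → let (X≡0 , W≡T) = proj₂ sq tight
                     (e≡0 , p≡k , q≡k) = even-excess e d s k imbalance colours (gap≡ n≡′) X≡0
                 in extremal e≡0 W≡T p≡k q≡k)
    , λ G≅ → trans (extremal-wiener 0 s 1≤m (sym (+-identityʳ k)) n≡ G≅) (+-identityʳ _)

  odd = λ k n≡′ → let (X′ , X≡1+X′ , unique) = odd-excess e d s k imbalance colours (gap≡ n≡′)
                      sq = squeeze (2 * m * n) (4 * n) template≤W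
                             (trans identity (trans (cong (A₀ +_) X≡1+X′) (sym (+-assoc A₀ 1 X′)))) in
    proj₁ sq
    , (λ tight → let (X′≡0 , W≡T) = proj₂ sq tight
                     (e≡0 , p≡1+k , q≡k) = unique X′≡0
                 in extremal e≡0 W≡T p≡1+k q≡k)
    , extremal-wiener 1 s 1≤m (sym (+-comm k 1)) n≡
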